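{- Let $X\in S_n$ be the preorder traversal sequence of a binary search tree on $[n]$. Then the cost of accessing $X$ using \textsc{Greedy} with (linear-cost) preprocessing, i.e. \textsc{Greedy} run without initial tree in the geometric view, is $O(n)$.
   Context: Geometric model: $X=(x_1,\dots,x_n)$ is the set of access points $\{(x_t,t)\}$ (key, time). $\square_{pq}$ is the closed axis-parallel rectangle with corners $p,q$. \textsc{Greedy} without initial tree: let $\tau(b,t)$ be the largest time $\le t$ at which column $b$ contains an output point (undefined if none). At time $t$ with access $(a,t)$, add $(a,t)$ and $(b,t)$ for each $b\ne a$ with $\tau(b,t-1)$ defined such that $\square_{(a,t),(b,\tau(b,t-1))}$ contains no output point at times $<t$ other than $(b,\tau(b,t-1))$. The cost is the number of output points. The preprocessing (putting keys in a split tree) corresponds exactly to running \textsc{Greedy} with no initial-tree points. -}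

module Defs where

open import Data.Bool using (Bool; true; false; _∧_; _∨_; not; if_then_else_)
open import Data.Nat using (ℕ; zero; suc; _⊔_; _⊓_; _≤ᵇ_; _≡ᵇ_)
open import Data.Bool.ListAction using (any; all)
open import Relation.Binary.PropositionalEquality using (_≡_)
open import Data.List using (List; []; _∷_; _++_; [_]; map; upTo; filterᵇ; length; foldr; reverse)

data Tree : Set where
  leaf : Tree
  node : Tree → ℕ → Tree → Tree

inorder : Tree → List ℕ
inorder leaf = []
inorder (node l k r) = inorder l ++ (k ∷ inorder r)

preorder : Tree → List ℕ
preorder leaf = []
preorder (node l k r) = k ∷ (preorder l ++ preorder r)

range1 : ℕ → List ℕ
range1 n = map suc (upTo n)

IsBSTOn : ℕ → Tree → Set
IsBSTOn n t = inorder t ≡ range1 n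

-- Greedy (geometric view, no initial tree).
-- A row is the list of keys of output points at one time step.
-- A history is the list of rows at previous times, MOST RECENT FIRST.

Row : Set
Row = List ℕ

inRect : ℕ → ℕ → ℕ → Bool
inRect a b k = ((a ⊓ b) ≤ᵇ k) ∧ (k ≤ᵇ (a ⊔ b))

_∈ᵇ_ : ℕ → List ℕ → Bool
k ∈ᵇ r = any (λ x → x ≡ᵇ k) r

-- ok a b hist = true iff τ(b, t-1) is defined and the closed rectangle with
-- corners (a,t) and (b,τ(b,t-1)) contains no output point at times < t
-- other than (b, τ(b,t-1)).
ok : ℕ → ℕ → List Row → Bool
ok a b [] = false
ok a b (r ∷ rs) =
  if b ∈ᵇ r
  then all (λ k → not (inRect a b k) ∨ (k ≡ᵇ b)) r
  else (not (any (inRect a b) r) ∧ ok a b rs)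

-- Candidate columns b range over 0..N, where N bounds all keys of the input
-- (every column containing an output point is an accessed key, hence ≤ N).
greedyRow : ℕ → List Row → ℕ → Row
greedyRow N hist a = a ∷ filterᵇ (λ b → not (b ≡ᵇ a) ∧ ok a b hist) (upTo (suc N))

greedyRun : ℕ → List Row → List ℕ → List Row
greedyRun N hist [] = hist
greedyRun N hist (a ∷ as) = greedyRun N (greedyRow N hist a ∷ hist) as

maxKey : List ℕ → ℕ
maxKey = foldr _⊔_ 0

greedyOutput : List ℕ → List Row
greedyOutput X = greedyRun (maxKey X) [] X

greedyCost : List ℕ → ℕ
greedyCost X = foldr (λ r acc → length r Data.Nat.+ acc) 0 (greedyOutput X)

module Submission where

-- A preorder sequence of a binary search tree avoids the pattern 231.  We run
-- Greedy on a 231-avoiding sequence and show that every row  a ∷ t  (access a,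
-- further output columns t) has  |t| ≤ 2 + |extras|:  at most one column of t
-- lies right of a, at most one lies left of a without another column of t
-- strictly between it and a, and the remaining ("extra") columns are charged to
-- themselves.  The heart of the proof is an invariant of the Greedy history
-- relating 231-avoidance of the future accesses to the order in which columns
-- were last touched; it implies both counting facts above and that no key is
-- ever extra twice.  Hence the extras of all rows are distinct keys ≤ maxKey,
-- and the cost is at most  3·|X| + maxKey + 1 ≤ 5n.

open import Defs
open import Data.Nat using (ℕ; _≤_; _*_)
open import Data.Product using (∃; _,_)
open import Data.Nat using (zero; suc; _+_; _<_; _≟_; _<?_; _≡ᵇ_; z≤n; s≤s; s≤s⁻¹)
open import Data.Nat.Properties
open import Data.Nat.Solver using (module +-*-Solver)
open import Data.Bool using (Bool; true; false; T; not; _∧_)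
open import Data.Bool.Properties using (T-∧; T-∨; T-≡)
open import Data.List using (List; []; _∷_; _++_; filter; filterᵇ; length; upTo; foldr; concatMap)
open import Data.List.Properties using (length-++; length-map; length-upTo; map-upTo)
open import Data.List.Relation.Unary.All as All using (All; []; _∷_)
open import Data.List.Relation.Unary.All.Properties as AllP using (all⁺)
open import Data.List.Relation.Unary.Any as Any using (Any; here; there; any?)
open import Data.List.Relation.Unary.Any.Properties using (any⁺; any⁻)
open import Data.List.Relation.Unary.AllPairs using (AllPairs; []; _∷_)
open import Data.List.Relation.Unary.AllPairs.Properties using (applyUpTo⁺₁)
open import Data.List.Relation.Unary.Unique.Propositional using (Unique)
import Data.List.Relation.Unary.Unique.Propositional.Properties as Unique
open import Data.List.Relation.Binary.Disjoint.Propositional using (Disjoint)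
open import Data.List.Relation.Binary.Permutation.Propositional
  using (_↭_; ↭-refl; ↭-sym; prep; module PermutationReasoning)
open import Data.List.Relation.Binary.Permutation.Propositional.Properties
  using (All-resp-↭; ↭-length; shift)
  renaming (++⁺ to ↭-++⁺)
open import Data.List.Membership.Propositional using (_∈_; _∉_; lose; find)
open import Data.List.Membership.Propositional.Properties using (∈-filter⁻; ∈-++⁻; ∈-upTo⁻)
open import Data.List.Membership.DecPropositional _≟_ using (_∈?_)
open import Data.Empty using (⊥; ⊥-elim)
open import Data.Unit using (⊤; tt)
open import Data.Sum using (inj₁; inj₂; [_,_]′)
open import Data.Product using (_×_; proj₁; proj₂)
open import Function using (_∘_; Equivalence)
open import Relation.Binary.PropositionalEquality hiding (preorder)
open import Relation.Binary.Definitions using (tri<; tri≈; tri>)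
open import Relation.Nullary using (¬_; yes; no; does)
open import Relation.Nullary.Decidable using (T?; _×-dec_)
open import Relation.Unary using (Pred; Decidable)
open import Relation.Unary.Properties using (∁?)

length-split : ∀ {a p} {A : Set a} {P : Pred A p} (P? : Decidable P) xs →
  length xs ≡ length (filter P? xs) + length (filter (∁? P?) xs)
length-split P? [] = refl
length-split P? (x ∷ xs) with does (P? x)
... | true  = cong suc (length-split P? xs)
... | false = trans (cong suc (length-split P? xs)) (sym (+-suc _ _))

atMostOne : ∀ {ys} → Unique ys → (∀ {x y} → x ∈ ys → y ∈ ys → x < y → ⊥) → length ys ≤ 1
atMostOne {[]} _ _ = z≤n
atMostOne {_ ∷ []} _ _ = s≤s z≤n
atMostOne {x ∷ y ∷ _} ((x≢y ∷ _) ∷ _) ordered with <-cmp x y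
... | tri< x<y _ _ = ⊥-elim (ordered (here refl) (there (here refl)) x<y)
... | tri≈ _ x≡y _ = ⊥-elim (x≢y x≡y)
... | tri> _ _ y<x = ⊥-elim (ordered (there (here refl)) (here refl) y<x)

unique-bounded : ∀ m {xs} → Unique xs → All (_< m) xs → length xs ≤ m
unique-bounded zero {[]} _ _ = z≤n
unique-bounded zero {_ ∷ _} _ (x<0 ∷ _) = ⊥-elim (n≮0 x<0)
unique-bounded (suc m) {xs} u below = begin
  length xs
    ≡⟨ length-split (_≟ m) xs ⟩
  length (filter (_≟ m) xs) + length (filter (∁? (_≟ m)) xs)
    ≤⟨ +-mono-≤ (atMostOne (Unique.filter⁺ _ u) equalToM)
                (unique-bounded m (Unique.filter⁺ _ u) belowM) ⟩
  1 + m ∎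
  where
  open ≤-Reasoning
  equalToM : ∀ {x y} → x ∈ filter (_≟ m) xs → y ∈ filter (_≟ m) xs → x < y → ⊥
  equalToM x∈ y∈ = <-irrefl (trans (proj₂ (∈-filter⁻ (_≟ m) {xs = xs} x∈)) (sym (proj₂ (∈-filter⁻ (_≟ m) {xs = xs} y∈))))
  belowM : All (_< m) (filter (∁? (_≟ m)) xs)
  belowM = All.tabulate λ x∈ → let (x∈xs , x≢m) = ∈-filter⁻ (∁? (_≟ m)) {xs = xs} x∈
                               in ≤∧≢⇒< (s≤s⁻¹ (All.lookup below x∈xs)) x≢m

AllPairs-++⁻ : ∀ {a r} {A : Set a} {R : A → A → Set r} xs {ys} → AllPairs R (xs ++ ys) →
  AllPairs R xs × AllPairs R ys × All (λ x → All (R x) ys) xs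
AllPairs-++⁻ [] pairs = [] , pairs , []
AllPairs-++⁻ (x ∷ xs) (x-rel ∷ pairs) =
  let (pairs-xs , pairs-ys , cross) = AllPairs-++⁻ xs pairs
  in (AllP.++⁻ˡ xs x-rel ∷ pairs-xs) , pairs-ys , (AllP.++⁻ʳ xs x-rel ∷ cross)

T-not⇒¬T : ∀ {b} → T (not b) → ¬ T b
T-not⇒¬T {false} _ ()

∈ᵇ⇒∈ : ∀ {k} r → T (k ∈ᵇ r) → k ∈ r
∈ᵇ⇒∈ {k} r h = Any.map (λ {x} x≡ᵇk → sym (≡ᵇ⇒≡ x k x≡ᵇk)) (any⁻ (λ x → x ≡ᵇ k) r h)

inRect-between : ∀ {a b k} → a ≤ k → k ≤ b → T (inRect a b k)
inRect-between {a} {b} {k} a≤k k≤b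
  rewrite m≤n⇒m⊓n≡m (≤-trans a≤k k≤b) | m≤n⇒m⊔n≡n (≤-trans a≤k k≤b)
  = Equivalence.from T-∧ (≤⇒≤ᵇ a≤k , ≤⇒≤ᵇ k≤b)

inRect-comm : ∀ a b k → inRect a b k ≡ inRect b a k
inRect-comm a b k rewrite ⊓-comm a b | ⊔-comm a b = refl

-- Recency of touches in a history (rows listed most recent first)

Touched : ℕ → List Row → Set
Touched k = Any (k ∈_)

touched-tail : ∀ {k r rs} → Touched k (r ∷ rs) → k ∉ r → Touched k rs
touched-tail (here k∈r) k∉r = ⊥-elim (k∉r k∈r)
touched-tail (there touched) _ = touched

-- AsRecent x y hist: the last touch of x is no earlier than that of y
-- (vacuously true if neither was ever touched).
data AsRecent (x y : ℕ) : List Row → Set where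
  never : AsRecent x y []
  hit   : ∀ {r rs} → x ∈ r → AsRecent x y (r ∷ rs)
  skip  : ∀ {r rs} → x ∉ r → y ∉ r → AsRecent x y rs → AsRecent x y (r ∷ rs)

asRecent-cons : ∀ {x y r rs} → (x ∉ r → y ∉ r × AsRecent x y rs) → AsRecent x y (r ∷ rs)
asRecent-cons {x} {r = r} kept with x ∈? r
... | yes x∈r = hit x∈r
... | no  x∉r = let (y∉r , recent) = kept x∉r in skip x∉r y∉r recent

record Visible (a b : ℕ) (hist : List Row) : Set where
  field
    touched : Touched b hist
    latest  : ∀ {k} → k ≢ b → T (inRect a b k) → ¬ AsRecent k b hist

ok⇒visible : ∀ a b hist → T (ok a b hist) → Visible a b hist
ok⇒visible a b (r ∷ rs) h with b ∈ᵇ r in b∈ᵇr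
... | true = record { touched = here b∈r ; latest = latest }
  where
  b∈r : b ∈ r
  b∈r = ∈ᵇ⇒∈ r (Equivalence.from T-≡ b∈ᵇr)
  latest : ∀ {k} → k ≢ b → T (inRect a b k) → ¬ AsRecent k b (r ∷ rs)
  latest {k} k≢b k-in (hit k∈r) =
    [ (λ k-out → T-not⇒¬T k-out k-in) , (λ k≡ᵇb → k≢b (≡ᵇ⇒≡ k b k≡ᵇb)) ]′
      (Equivalence.to T-∨ (All.lookup (all⁺ _ r h) k∈r))
  latest _ _ (skip _ b∉r _) = b∉r b∈r
... | false = record { touched = there (Visible.touched earlier) ; latest = latest }
  where
  rowClear = proj₁ (Equivalence.to T-∧ h)
  earlier  = ok⇒visible a b rs (proj₂ (Equivalence.to T-∧ h))
  latest : ∀ {k} → k ≢ b → T (inRect a b k) → ¬ AsRecent k b (r ∷ rs)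
  latest _ k-in (hit k∈r) = T-not⇒¬T rowClear (any⁺ (inRect a b) (lose k∈r k-in))
  latest k≢b k-in (skip _ _ recent) = Visible.latest earlier k≢b k-in recent

-- 231-avoidance

-- No231From x ys: no y, z occur in this order in ys with z < x < y.
No231From : ℕ → List ℕ → Set
No231From x [] = ⊤
No231From x (y ∷ ys) = (x < y → All (x <_) ys) × No231From x ys

Avoids231 : List ℕ → Set
Avoids231 [] = ⊤
Avoids231 (x ∷ xs) = No231From x xs × Avoids231 xs

no231-below : ∀ {x ys} → All (_< x) ys → No231From x ys
no231-below [] = tt
no231-below (y<x ∷ below) = (λ x<y → ⊥-elim (<-asym x<y y<x)) , no231-below below

no231-above : ∀ {x ys} → All (x <_) ys → No231From x ys
no231-above [] = tt
no231-above (_ ∷ above) = (λ _ → above) , no231-above above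

no231-++ : ∀ {x} xs {ys} → No231From x xs → All (x <_) ys → No231From x (xs ++ ys)
no231-++ [] _ above = no231-above above
no231-++ (_ ∷ xs) (after , rest) above = (λ x<y → AllP.++⁺ (after x<y) above) , no231-++ xs rest above

avoids231-++ : ∀ xs {ys} → Avoids231 xs → Avoids231 ys → All (λ x → All (x <_) ys) xs →
  Avoids231 (xs ++ ys)
avoids231-++ [] _ avoids-ys _ = avoids-ys
avoids231-++ (_ ∷ xs) (head , avoids-xs) avoids-ys (above ∷ cross) =
  no231-++ xs head above , avoids231-++ xs avoids-xs avoids-ys cross

Extra : ℕ → List ℕ → ℕ → Set
Extra a t x = x < a × Any (λ k → x < k × k < a) t

extra? : ∀ a t → Decidable (Extra a t)
extra? a t x = (x <? a) ×-dec any? (λ k → (x <? k) ×-dec (k <? a)) t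

extras : Row → List ℕ
extras [] = []
extras (a ∷ t) = filter (extra? a t) t

AddedBelow : ℕ → ℕ → Row → Set
AddedBelow b k [] = ⊥
AddedBelow b k (a ∷ t) = b ∈ t × k ∈ t × k < a

extra⇒addedBelow : ∀ {x} r → x ∈ extras r → ∃ λ k → x < k × AddedBelow x k r
extra⇒addedBelow (a ∷ t) x∈extras =
  let (x∈t , _ , between) = ∈-filter⁻ (extra? a t) {xs = t} x∈extras
      (k , k∈t , x<k , k<a) = find between
  in k , x<k , x∈t , k∈t , k<a

allExtras⇒addedBelow : ∀ {x} hist → x ∈ concatMap extras hist →
  ∃ λ k → x < k × Any (AddedBelow x k) hist
allExtras⇒addedBelow (r ∷ rs) x∈ with ∈-++⁻ (extras r) x∈
... | inj₁ x∈r  = let (k , x<k , below) = extra⇒addedBelow r x∈r in k , x<k , here below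
... | inj₂ x∈rs = let (k , x<k , below) = allExtras⇒addedBelow rs x∈rs in k , x<k , there below

-- The Greedy invariant

record Invariant (hist : List Row) (as : List ℕ) : Set where
  field
    future-avoids  : Avoids231 as
    touched-avoids : ∀ {k} → Touched k hist → No231From k as
    lower-first    : ∀ {b₁ b₂} → b₁ < b₂ → Touched b₁ hist → Touched b₂ hist →
                     Any (_< b₁) as → AsRecent b₁ b₂ hist
    upper-first    : ∀ {b k} → b < k → Any (AddedBelow b k) hist →
                     AsRecent k b hist × All (k <_) as

initialInvariant : ∀ {as} → Avoids231 as → Invariant [] as
initialInvariant avoids = record
  { future-avoids = avoids ; touched-avoids = λ () ; lower-first = λ _ () ; upper-first = λ _ () }

RowBounded : Row → Set
RowBounded r = length r ≤ 3 + length (extras r)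

record Accounting (N : ℕ) (hist : List Row) : Set where
  field
    rows-bounded  : All RowBounded hist
    extras-unique : Unique (concatMap extras hist)
    extras-below  : All (_< suc N) (concatMap extras hist)

emptyAccounting : ∀ {N} → Accounting N []
emptyAccounting = record { rows-bounded = [] ; extras-unique = [] ; extras-below = [] }

module GreedyStep (N : ℕ) (hist : List Row) (a : ℕ) (as : List ℕ)
                  (inv : Invariant hist (a ∷ as)) where
  open Invariant inv

  addable : ℕ → Bool
  addable b = not (b ≡ᵇ a) ∧ ok a b hist

  added : List ℕ
  added = filterᵇ addable (upTo (suc N))

  row : Row
  row = greedyRow N hist a

  added-unique : Unique added
  added-unique = Unique.filter⁺ (T? ∘ addable) (Unique.upTo⁺ (suc N))

  added-spec : ∀ {b} → b ∈ added → b ≢ a × Visible a b hist × b < suc N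
  added-spec {b} b∈ =
    let (b∈upTo , addable-b) = ∈-filter⁻ (T? ∘ addable) {xs = upTo (suc N)} b∈
        (b≢ᵇa , ok-b) = Equivalence.to T-∧ addable-b
    in (λ b≡a → T-not⇒¬T b≢ᵇa (≡⇒≡ᵇ b a b≡a)) , ok⇒visible a b hist ok-b , ∈-upTo⁻ b∈upTo

  added≢a : ∀ {b} → b ∈ added → b ≢ a
  added≢a = proj₁ ∘ added-spec

  visible : ∀ {b} → b ∈ added → Visible a b hist
  visible = proj₁ ∘ proj₂ ∘ added-spec

  added-below : ∀ {b} → b ∈ added → b < suc N
  added-below = proj₂ ∘ proj₂ ∘ added-spec

  touched : ∀ {b} → b ∈ added → Touched b hist
  touched = Visible.touched ∘ visible

  noLowerFuture : ∀ {b} → Touched b hist → b < a → ¬ Any (_< b) as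
  noLowerFuture tb b<a low =
    let (y , y∈as , y<b) = find low
    in <-asym (All.lookup (proj₁ (touched-avoids tb) b<a) y∈as) y<b

  rightShadow : ∀ {x y} → x < y → a < x → Touched x hist → y ∈ added → ⊥
  rightShadow x<y a<x tx y∈ =
    Visible.latest (visible y∈) (<⇒≢ x<y) (inRect-between (<⇒≤ a<x) (<⇒≤ x<y))
      (lower-first x<y tx (touched y∈) (here a<x))

  leftShadow : ∀ {b k} → b < k → k < a → b ∈ added → ¬ AsRecent k b hist
  leftShadow {b} {k} b<k k<a b∈ =
    Visible.latest (visible b∈) (>⇒≢ b<k)
      (subst T (inRect-comm b a k) (inRect-between (<⇒≤ b<k) (<⇒≤ k<a)))

  -- Row bound: besides a and its extras, the row has one column right of a
  -- and one non-extra column left of a, at most.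
  nonExtra : List ℕ
  nonExtra = filter (∁? (extra? a added)) added

  right left : List ℕ
  right = filter (a <?_) nonExtra
  left  = filter (∁? (a <?_)) nonExtra

  nonExtra-unique : Unique nonExtra
  nonExtra-unique = Unique.filter⁺ _ added-unique

  right-atMostOne : length right ≤ 1
  right-atMostOne = atMostOne (Unique.filter⁺ _ nonExtra-unique) λ x∈ y∈ x<y →
    let (x∈ne , a<x) = ∈-filter⁻ (a <?_) {xs = nonExtra} x∈
        (y∈ne , _)   = ∈-filter⁻ (a <?_) {xs = nonExtra} y∈
        x∈added = proj₁ (∈-filter⁻ (∁? (extra? a added)) {xs = added} x∈ne)
        y∈added = proj₁ (∈-filter⁻ (∁? (extra? a added)) {xs = added} y∈ne)
    in rightShadow x<y a<x (touched x∈added) y∈added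

  left-atMostOne : length left ≤ 1
  left-atMostOne = atMostOne (Unique.filter⁺ _ nonExtra-unique) λ x∈ y∈ x<y →
    let (x∈ne , a≮x) = ∈-filter⁻ (∁? (a <?_)) {xs = nonExtra} x∈
        (y∈ne , a≮y) = ∈-filter⁻ (∁? (a <?_)) {xs = nonExtra} y∈
        (x∈added , notExtra) = ∈-filter⁻ (∁? (extra? a added)) {xs = added} x∈ne
        y∈added = proj₁ (∈-filter⁻ (∁? (extra? a added)) {xs = added} y∈ne)
        y<a = ≤∧≢⇒< (≮⇒≥ a≮y) (added≢a y∈added)
    in notExtra (<-trans x<y y<a , lose y∈added (x<y , y<a))

  rowBounded : RowBounded row
  rowBounded = s≤s (begin
    length added
      ≡⟨ length-split (extra? a added) added ⟩
    length (extras row) + length nonExtra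
      ≡⟨ cong (length (extras row) +_) (length-split (a <?_) nonExtra) ⟩
    length (extras row) + (length right + length left)
      ≤⟨ +-monoʳ-≤ (length (extras row)) (+-mono-≤ right-atMostOne left-atMostOne) ⟩
    length (extras row) + 2
      ≡⟨ +-comm (length (extras row)) 2 ⟩
    2 + length (extras row) ∎)
    where open ≤-Reasoning

  touched-avoids′ : ∀ {k} → Touched k (row ∷ hist) → No231From k as
  touched-avoids′ (here (here refl)) = proj₁ future-avoids
  touched-avoids′ (here (there k∈))  = proj₂ (touched-avoids (touched k∈))
  touched-avoids′ (there tk)         = proj₂ (touched-avoids tk)

  lower-first′ : ∀ {b₁ b₂} → b₁ < b₂ → Touched b₁ (row ∷ hist) → Touched b₂ (row ∷ hist) →
                 Any (_< b₁) as → AsRecent b₁ b₂ (row ∷ hist)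
  lower-first′ {b₁} {b₂} b₁<b₂ t₁ t₂ low = asRecent-cons λ b₁∉ →
    let t₁′ = touched-tail t₁ b₁∉
        b₂∉ = b₂∉row b₁∉ t₁′
    in b₂∉ , lower-first b₁<b₂ t₁′ (touched-tail t₂ b₂∉) (there low)
    where
    b₂∉row : b₁ ∉ row → Touched b₁ hist → b₂ ∉ row
    b₂∉row _ t₁′ (here b₂≡a) = noLowerFuture t₁′ (subst (b₁ <_) b₂≡a b₁<b₂) low
    b₂∉row b₁∉ t₁′ (there b₂∈) with <-cmp b₁ a
    ... | tri< b₁<a _ _ = noLowerFuture t₁′ b₁<a low
    ... | tri≈ _ b₁≡a _ = b₁∉ (here b₁≡a)
    ... | tri> _ _ a<b₁ = rightShadow b₁<b₂ a<b₁ t₁′ b₂∈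

  upper-first′ : ∀ {b k} → b < k → Any (AddedBelow b k) (row ∷ hist) →
                 AsRecent k b (row ∷ hist) × All (k <_) as
  upper-first′ b<k (here (_ , k∈ , k<a)) =
    hit (there k∈) , proj₁ (touched-avoids (touched k∈)) k<a
  upper-first′ {b} {k} b<k (there below) with upper-first b<k below
  ... | recent , k<a ∷ above = asRecent-cons (λ _ → b∉row , recent) , above
    where
    b∉row : b ∉ row
    b∉row (here b≡a)  = <-irrefl b≡a (<-trans b<k k<a)
    b∉row (there b∈) = leftShadow b<k k<a b∈ recent

  invariant-step : Invariant (row ∷ hist) as
  invariant-step = record
    { future-avoids  = proj₂ future-avoids
    ; touched-avoids = touched-avoids′
    ; lower-first    = lower-first′
    ; upper-first    = upper-first′ }

  extras-disjoint : Disjoint (extras row) (concatMap extras hist)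
  extras-disjoint (x∈new , x∈old) with allExtras⇒addedBelow hist x∈old
  ... | k , x<k , below with upper-first x<k below
  ... | recent , k<a ∷ _ =
    leftShadow x<k k<a (proj₁ (∈-filter⁻ (extra? a added) {xs = added} x∈new)) recent

  accounting-step : Accounting N hist → Accounting N (row ∷ hist)
  accounting-step acc = record
    { rows-bounded  = rowBounded ∷ rows-bounded
    ; extras-unique = Unique.++⁺ (Unique.filter⁺ _ added-unique) extras-unique extras-disjoint
    ; extras-below  = AllP.++⁺ (All.tabulate λ x∈ →
                        added-below (proj₁ (∈-filter⁻ (extra? a added) {xs = added} x∈)))
                        extras-below }
    where open Accounting acc

greedyRun-accounting : ∀ N hist as → Invariant hist as → Accounting N hist →
  Accounting N (greedyRun N hist as)
greedyRun-accounting N hist [] _ acc = acc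
greedyRun-accounting N hist (a ∷ as) inv acc =
  greedyRun-accounting N (row ∷ hist) as invariant-step (accounting-step acc)
  where open GreedyStep N hist a as inv

length-greedyRun : ∀ N hist as → length (greedyRun N hist as) ≡ length as + length hist
length-greedyRun N hist [] = refl
length-greedyRun N hist (a ∷ as) =
  trans (length-greedyRun N (greedyRow N hist a ∷ hist) as) (+-suc (length as) (length hist))

rowsCost : List Row → ℕ
rowsCost = foldr (λ r acc → length r + acc) 0

rowsCost-bound : ∀ hist → All RowBounded hist →
  rowsCost hist ≤ 3 * length hist + length (concatMap extras hist)
rowsCost-bound [] [] = z≤n
rowsCost-bound (r ∷ rs) (r-bounded ∷ rs-bounded) = begin
  length r + rowsCost rs
    ≤⟨ +-mono-≤ r-bounded (rowsCost-bound rs rs-bounded) ⟩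
  (3 + length (extras r)) + (3 * length rs + length (concatMap extras rs))
    ≡⟨ regroup (length (extras r)) (length rs) (length (concatMap extras rs)) ⟩
  3 * suc (length rs) + (length (extras r) + length (concatMap extras rs))
    ≡⟨ cong (3 * suc (length rs) +_) (sym (length-++ (extras r))) ⟩
  3 * suc (length rs) + length (extras r ++ concatMap extras rs) ∎
  where
  open ≤-Reasoning
  open +-*-Solver
  regroup : ∀ e m c → (3 + e) + (3 * m + c) ≡ 3 * suc m + (e + c)
  regroup = solve 3 (λ e m c → (con 3 :+ e) :+ (con 3 :* m :+ c) := con 3 :* (con 1 :+ m) :+ (e :+ c)) refl

-- Each row costs at most 3 plus its extras, and the extras are distinct keys.
greedyCost-bound : ∀ X → Avoids231 X → greedyCost X ≤ 3 * length X + suc (maxKey X)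
greedyCost-bound X avoids = begin
  rowsCost (greedyOutput X)
    ≤⟨ rowsCost-bound (greedyOutput X) rows-bounded ⟩
  3 * length (greedyOutput X) + length (concatMap extras (greedyOutput X))
    ≤⟨ +-mono-≤ (≤-reflexive (cong (3 *_) length-output)) (unique-bounded _ extras-unique extras-below) ⟩
  3 * length X + suc (maxKey X) ∎
  where
  open ≤-Reasoning
  open Accounting (greedyRun-accounting (maxKey X) [] X (initialInvariant avoids) emptyAccounting)
  length-output : length (greedyOutput X) ≡ length X
  length-output = trans (length-greedyRun (maxKey X) [] X) (+-identityʳ (length X))

-- Preorder sequences of binary search trees

preorder↭inorder : ∀ t → preorder t ↭ inorder t
preorder↭inorder leaf = ↭-refl
preorder↭inorder (node l k r) = begin
  k ∷ preorder l ++ preorder r ↭⟨ prep k (↭-++⁺ (preorder↭inorder l) (preorder↭inorder r)) ⟩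
  k ∷ inorder l ++ inorder r   ↭⟨ ↭-sym (shift k (inorder l) (inorder r)) ⟩
  inorder l ++ k ∷ inorder r   ∎
  where open PermutationReasoning

-- The root precedes its smaller left subtree and larger right subtree.
preorder-avoids231 : ∀ t → AllPairs _<_ (inorder t) → Avoids231 (preorder t)
preorder-avoids231 leaf _ = tt
preorder-avoids231 (node l k r) sorted with AllPairs-++⁻ (inorder l) sorted
... | sorted-l , (k<inorder-r ∷ sorted-r) , cross =
  no231-++ (preorder l) (no231-below left<k) right>k ,
  avoids231-++ (preorder l) (preorder-avoids231 l sorted-l) (preorder-avoids231 r sorted-r)
    (All.map (λ x<k → All.map (<-trans x<k) right>k) left<k)
  where
  left<k : All (_< k) (preorder l)
  left<k = All-resp-↭ (↭-sym (preorder↭inorder l)) (All.map All.head cross)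
  right>k : All (k <_) (preorder r)
  right>k = All-resp-↭ (↭-sym (preorder↭inorder r)) k<inorder-r

range1-sorted : ∀ n → AllPairs _<_ (range1 n)
range1-sorted n rewrite map-upTo suc n = applyUpTo⁺₁ suc n (λ i<j _ → s≤s i<j)

range1-≤ : ∀ n → All (_≤ n) (range1 n)
range1-≤ n = AllP.map⁺ (All.tabulate ∈-upTo⁻)

length-range1 : ∀ n → length (range1 n) ≡ n
length-range1 n = trans (length-map suc (upTo n)) (length-upTo n)

maxKey-lub : ∀ {n} xs → All (_≤ n) xs → maxKey xs ≤ n
maxKey-lub [] [] = z≤n
maxKey-lub (_ ∷ xs) (x≤n ∷ xs≤n) = ⊔-lub x≤n (maxKey-lub xs xs≤n)

preorder-keys : ∀ {n} t → IsBSTOn n t → preorder t ↭ range1 n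
preorder-keys t bst = subst (preorder t ↭_) bst (preorder↭inorder t)

linear-slack : ∀ {m n} → 1 ≤ n → m ≤ n → 3 * n + suc m ≤ 5 * n
linear-slack {m} {n} 1≤n m≤n = begin
  3 * n + (1 + m) ≤⟨ +-monoʳ-≤ (3 * n) (+-mono-≤ 1≤n m≤n) ⟩
  3 * n + (n + n) ≡⟨ solve 1 (λ n → con 3 :* n :+ (n :+ n) := con 5 :* n) refl n ⟩
  5 * n           ∎
  where
  open ≤-Reasoning
  open +-*-Solver

mainTheorem5 : ∃ λ (c : ℕ) → ∃ λ (n₀ : ℕ) →
    ∀ (n : ℕ) → n₀ ≤ n → (t : Tree) → IsBSTOn n t →
    greedyCost (preorder t) ≤ c * n
mainTheorem5 = 5 , 1 , bound
  where
  bound : ∀ n → 1 ≤ n → (t : Tree) → IsBSTOn n t → greedyCost (preorder t) ≤ 5 * n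
  bound n 1≤n t bst = begin
    greedyCost (preorder t)
      ≤⟨ greedyCost-bound (preorder t) (preorder-avoids231 t (subst (AllPairs _<_) (sym bst) (range1-sorted n))) ⟩
    3 * length (preorder t) + suc (maxKey (preorder t))
      ≡⟨ cong (λ len → 3 * len + suc (maxKey (preorder t))) (trans (↭-length keys) (length-range1 n)) ⟩
    3 * n + suc (maxKey (preorder t))
      ≤⟨ linear-slack 1≤n (maxKey-lub (preorder t) (All-resp-↭ (↭-sym keys) (range1-≤ n))) ⟩
    5 * n ∎
    where
    open ≤-Reasoning
    keys : preorder t ↭ range1 n
    keys = preorder-keys t bst
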